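{- Let $p$ be an odd prime, $q$ a power of $p$, and $k$ an integer with $0\le k\le p-1$. For an integer $n\ge 0$, the polynomial $D_{n,k}(0,x)\in\mathbb{F}_q[x]$ is a permutation polynomial of $\mathbb{F}_q$ if and only if $k\neq 2$ and $n=2l$ for some integer $l$ with $\gcd(l,q-1)=1$.
   Context: For $a\in\mathbb{F}_q$ and integer $n\ge 1$, the $n$-th reversed Dickson polynomial of the $(k+1)$-th kind is $D_{n,k}(a,x)=\sum_{i=0}^{\lfloor n/2\rfloor}\frac{n-ki}{n-i}\binom{n-i}{i}(-x)^i a^{n-2i}\in\mathbb{F}_q[x]$ (the rational numbers $\frac{n-ki}{n-i}\binom{n-i}{i}$ are integers, reduced mod $p$; $a^0=1$), and $D_{0,k}(a,x)=2-k$. A polynomial $f\in\mathbb{F}_q[x]$ is a permutation polynomial (PP) of $\mathbb{F}_q$ if $x\mapsto f(x)$ is a bijection of $\mathbb{F}_q$. -}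

module Defs where

open import Level using (Level; _⊔_) renaming (suc to lsuc)
open import Data.Nat as ℕ using (ℕ; zero; suc; _∸_; ⌊_/2⌋)
open import Data.Nat.Combinatorics using (_C_)
open import Data.Integer as ℤ using (ℤ; +_; -[1+_])
open import Data.Integer.DivMod using (_/ℕ_)
open import Data.Fin using (Fin)
open import Data.Product using (Σ)
open import Relation.Nullary using (¬_)
open import Relation.Binary.PropositionalEquality as ≡ using (_≡_)
open import Function.Bundles using (Inverse)
open import Function.Definitions using (Bijective)
open import Algebra.Bundles using (CommutativeRing; Semiring)
import Algebra.Definitions.RawSemiring as RS

record Field (c ℓ : Level) : Set (lsuc (c ⊔ ℓ)) where
  field
    commRing  : CommutativeRing c ℓ
  open CommutativeRing commRing public
  field
    1≉0       : ¬ (1# ≈ 0#)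
    inverse   : ∀ x → ¬ (x ≈ 0#) → Σ Carrier (λ y → (x * y) ≈ 1#)

record FiniteField (c ℓ : Level) (q : ℕ) : Set (lsuc (c ⊔ ℓ)) where
  field
    fld  : Field c ℓ
  open Field fld public
  field
    card : Inverse setoid (≡.setoid (Fin q))

module _ {c ℓ : Level} {q : ℕ} (F : FiniteField c ℓ q) where
  open FiniteField F using (Carrier; _≈_; _+_; _*_; -_; 0#; 1#; semiring)
  open RS (Semiring.rawSemiring semiring) using (_^_) renaming (_×_ to _·_)

  ⟦_⟧ℤ : ℤ → Carrier
  ⟦ + n ⟧ℤ      = n · 1#
  ⟦ -[1+ n ] ⟧ℤ = - (suc n · 1#)

  -- permutation polynomial (given by its evaluation map): x ↦ f x is a
  -- bijection of F (with respect to the field equality).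
  IsPP : (Carrier → Carrier) → Set (c ⊔ ℓ)
  IsPP f = Bijective _≈_ _≈_ f

  sumUpTo : ℕ → (ℕ → Carrier) → Carrier
  sumUpTo zero    f = f zero
  sumUpTo (suc m) f = sumUpTo m f + f (suc m)

  -- the integer ((n - k i)/(n - i)) * binom(n-i, i)  (exact division in ℤ;
  -- the case n - i = 0 never occurs for n ≥ 1, i ≤ ⌊n/2⌋)
  coeff : ℕ → ℕ → ℕ → ℤ
  coeff n k i with n ∸ i
  ... | zero  = + 0
  ... | suc m = ((+ n ℤ.- + (k ℕ.* i)) ℤ.* + ((n ∸ i) C i)) /ℕ suc m

  D : ℕ → ℕ → Carrier → Carrier → Carrier
  D zero    k a x = ⟦ + 2 ℤ.- + k ⟧ℤ
  D (suc n) k a x =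
    sumUpTo ⌊ suc n /2⌋ (λ i →
      (⟦ coeff (suc n) k i ⟧ℤ * ((- x) ^ i)) * (a ^ (suc n ∸ 2 ℕ.* i)))

{-# OPTIONS --safe #-}
module Submission where

-- Every term of D_{n,k}(a,x) except the one with i = n/2 carries a positive power of a, so
-- D_{n,k}(0,x) = 0 for odd n and D_{2l,k}(0,x) = (2-k)(-x)^l. Summing F before and after a
-- translation by 1 gives q·1 = 0, so F has characteristic p and 2-k ≠ 0 in F for k < p unless
-- k = 2. It remains to see that x ↦ x^l permutes F exactly when gcd(l,q-1) = 1. If so,
-- x^l = y^l with y ≠ 0 gives (x/y)^l = 1 = (x/y)^{q-1} (Fermat), hence x = y by Bézout. If
-- instead d = gcd(l,q-1) > 1, then x ↦ x^d is injective, hence onto, so every element is a root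
-- of x^{(q-1)/d+1} - x, a nonzero polynomial of degree < q.

open import Defs
open import Level using (Level)
open import Data.Nat as ℕ using (ℕ; zero; suc; NonZero; z≤n; s≤s; z<s)
import Data.Nat.Properties as ℕ
open import Data.Nat.DivMod using (m*n/n≡m; m*n%n≡0)
open import Data.Nat.Divisibility using (_∣_; divides; ∣-trans; ∣1⇒≡1)
open import Data.Nat.Coprimality using (Coprime; coprime-Bézout; coprime-divisor; prime⇒coprime; gcd≡1⇒coprime)
open import Data.Nat.GCD using (gcd; gcd[m,n]∣m; gcd[m,n]∣n; gcd-identityˡ; module Bézout)
open import Data.Nat.Primality using (Prime; prime⇒nonZero; prime⇒nonTrivial)
open import Data.Nat.Combinatorics using (_C_; nCn≡1)
open import Data.Integer as ℤ using (ℤ; +_; -[1+_])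
import Data.Integer.Properties as ℤ
open import Data.Fin as Fin using (Fin)
import Data.Fin.Properties as Fin
open import Data.Fin.Permutation using (Permutation)
open import Data.List using (List; []; _∷_; length)
open import Data.List.Relation.Unary.All using (All; []; _∷_)
open import Data.Product using (Σ; _×_; _,_; proj₁; proj₂; ∃; uncurry; <_,_>)
open import Data.Sum using (_⊎_; inj₁; inj₂)
open import Data.Empty using (⊥-elim)
open import Function using (_∘_; id)
open import Function.Bundles using (Inverse; Injection; _⇔_; mk⇔; Equivalence)
open import Function.Definitions using (Injective; Surjective; Congruent)
open import Function.Properties.Inverse using (Inverse⇒Injection)
import Function.Construct.Symmetry as Symmetry
import Function.Construct.Composition as Composition
open import Relation.Nullary using (¬_; yes; no; contradiction)
open import Relation.Nullary.Decidable using (decidable-stable)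
import Relation.Nullary.Decidable as Dec
open import Relation.Binary.Definitions using (Decidable)
open import Relation.Binary.PropositionalEquality as ≡ using (_≡_; _≢_)
open import Algebra.Bundles using (Monoid; CommutativeMonoid; Semiring)
import Algebra.Definitions.RawMonoid
import Algebra.Definitions.RawSemiring as RS
import Algebra.Properties.Monoid.Mult
import Algebra.Properties.Monoid.Sum
import Algebra.Properties.CommutativeMonoid.Sum
import Algebra.Properties.Group
import Algebra.Properties.Ring
import Algebra.Properties.Semiring.Exp
import Algebra.Properties.CommutativeSemiring.Exp
open import Data.Maybe using (nothing)
open import Tactic.RingSolver.Core.AlmostCommutativeRing using (fromCommutativeRing)
import Tactic.RingSolver.NonReflective

even⊎odd : ∀ n → (∃ λ l → n ≡ 2 ℕ.* l) ⊎ (∃ λ l → n ≡ suc (2 ℕ.* l))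
even⊎odd zero = inj₁ (0 , ≡.refl)
even⊎odd (suc n) with even⊎odd n
... | inj₁ (l , ≡.refl) = inj₂ (l , ≡.refl)
... | inj₂ (l , ≡.refl) = inj₁ (suc l , ≡.cong suc (≡.sym (ℕ.+-suc l (l ℕ.+ 0))))

⌊2n/2⌋≡n : ∀ n → ℕ.⌊ 2 ℕ.* n /2⌋ ≡ n
⌊2n/2⌋≡n zero    = ≡.refl
⌊2n/2⌋≡n (suc n) = ≡.trans (≡.cong (ℕ.⌊_/2⌋ ∘ suc) (ℕ.+-suc n (n ℕ.+ 0))) (≡.cong suc (⌊2n/2⌋≡n n))

⌊1+2n/2⌋≡n : ∀ n → ℕ.⌊ suc (2 ℕ.* n) /2⌋ ≡ n
⌊1+2n/2⌋≡n zero    = ≡.refl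
⌊1+2n/2⌋≡n (suc n) = ≡.trans (≡.cong (suc ∘ ℕ.⌊_/2⌋) (ℕ.+-suc n (n ℕ.+ 0))) (≡.cong suc (⌊1+2n/2⌋≡n n))

[i*n]/ℕn≡i : ∀ i n .{{_ : NonZero n}} → (i ℤ.* + n) ℤ./ℕ n ≡ i
[i*n]/ℕn≡i (+ a)    n = ≡.trans (≡.cong (ℤ._/ℕ n) (≡.sym (ℤ.pos-* a n))) (≡.cong +_ (m*n/n≡m a n))
[i*n]/ℕn≡i -[1+ a ] n@(suc _) with suc a ℕ.* n ℕ.% n | m*n%n≡0 (suc a) n
... | .0 | ≡.refl = ≡.cong (λ m → ℤ.- (+ m)) (m*n/n≡m (suc a) n)

middle-coefficient : ∀ k L .{{_ : NonZero L}} →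
                     ((+ (2 ℕ.* L) ℤ.- + (k ℕ.* L)) ℤ.* + (L C L)) ℤ./ℕ L ≡ + 2 ℤ.- + k
middle-coefficient k L = begin
  (N ℤ.* + (L C L)) ℤ./ℕ L        ≡⟨ ≡.cong (λ t → (N ℤ.* + t) ℤ./ℕ L) (nCn≡1 L) ⟩
  (N ℤ.* + 1) ℤ./ℕ L              ≡⟨ ≡.cong (ℤ._/ℕ L) (ℤ.*-identityʳ N) ⟩
  N ℤ./ℕ L                        ≡⟨ ≡.cong (ℤ._/ℕ L) N≡[2-k]L ⟩
  ((+ 2 ℤ.- + k) ℤ.* + L) ℤ./ℕ L  ≡⟨ [i*n]/ℕn≡i (+ 2 ℤ.- + k) L ⟩
  + 2 ℤ.- + k                     ∎
  where
  open ≡.≡-Reasoning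
  N = + (2 ℕ.* L) ℤ.- + (k ℕ.* L)
  N≡[2-k]L : N ≡ (+ 2 ℤ.- + k) ℤ.* + L
  N≡[2-k]L = ≡.sym (≡.trans (ℤ.*-distribʳ-+ (+ L) (+ 2) (ℤ.- + k)) (≡.cong₂ ℤ._+_
    (≡.sym (ℤ.pos-* 2 L))
    (≡.trans (≡.sym (ℤ.neg-distribˡ-* (+ k) (+ L))) (≡.cong ℤ.-_ (≡.sym (ℤ.pos-* k L))))))

coprime-^ˡ : ∀ {a b} m → Coprime a b → Coprime (a ℕ.^ m) b
coprime-^ˡ zero    _   (d∣1 , _) = ∣1⇒≡1 d∣1
coprime-^ˡ (suc m) a⊥b {d} (d∣a*aᵐ , d∣b) = coprime-^ˡ m a⊥b (coprime-divisor d⊥a d∣a*aᵐ , d∣b)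
  where
  d⊥a : Coprime d _
  d⊥a (e∣d , e∣a) = a⊥b (e∣a , ∣-trans e∣d d∣b)

odd-prime⇒3≤p : ∀ {p} → Prime p → p ≢ 2 → 3 ℕ.≤ p
odd-prime⇒3≤p {p} p-prime p≢2 =
  ℕ.≤∧≢⇒< (ℕ.nonTrivial⇒n>1 p {{prime⇒nonTrivial p-prime}}) (p≢2 ∘ ≡.sym)

odd-prime⇒3≤pᵐ : ∀ {p m} → Prime p → p ≢ 2 → 1 ℕ.≤ m → 3 ℕ.≤ p ℕ.^ m
odd-prime⇒3≤pᵐ {p} {m} p-prime p≢2 1≤m = ℕ.≤-trans (odd-prime⇒3≤p p-prime p≢2) (ℕ.≤-trans
  (ℕ.≤-reflexive (≡.sym (ℕ.^-identityʳ p)))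
  (ℕ.^-monoʳ-≤ p {{prime⇒nonZero p-prime}} 1≤m))

cofactor-bound : ∀ {n s d} → 1 ℕ.≤ n → n ℕ.∸ 1 ≡ suc s ℕ.* suc (suc d) → 3 ℕ.+ s ℕ.≤ n
cofactor-bound {n} {s} {d} 1≤n n-1≡[1+s][2+d] = ≡.subst (3 ℕ.+ s ℕ.≤_) (ℕ.m+[n∸m]≡n 1≤n)
  (s≤s (≡.subst (2 ℕ.+ s ℕ.≤_) (≡.sym n-1≡[1+s][2+d])
    (ℕ.+-mono-≤ (s≤s (s≤s z≤n)) (ℕ.m≤m*n s (suc (suc d))))))

Fin-injective⇒surjective : ∀ {n} (g : Fin n → Fin n) → Injective _≡_ _≡_ g → ∀ y → ∃ λ x → g x ≡ y
Fin-injective⇒surjective {suc n} g g-inj y =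
  decidable-stable (Fin.any? λ x → g x Fin.≟ y) λ y∉image →
    let miss : ∀ x → y ≢ g x
        miss x y≡gx = y∉image (x , ≡.sym y≡gx)
        (i , j , i<j , eq) = Fin.pigeonhole (ℕ.n<1+n n) (λ x → Fin.punchOut (miss x))
    in Fin.<⇒≢ i<j (g-inj (Fin.punchOut-injective (miss i) (miss j) eq))

module _ {a r} (M : Monoid a r) where
  open Monoid M
  open Algebra.Definitions.RawMonoid rawMonoid using () renaming (_×_ to _·_)
  open Algebra.Properties.Monoid.Mult M using (×-assocˡ; ×-congʳ)
  open Algebra.Properties.Monoid.Sum M using (sum; sum-cong-≋; sum-replicate)
  open import Relation.Binary.Reasoning.Setoid setoid

  n·ε≈ε : ∀ n → n · ε ≈ ε
  n·ε≈ε zero    = refl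
  n·ε≈ε (suc n) = trans (identityˡ _) (n·ε≈ε n)

  n·x≈ε⇒[m*n]·x≈ε : ∀ {n x} m → n · x ≈ ε → (m ℕ.* n) · x ≈ ε
  n·x≈ε⇒[m*n]·x≈ε {n} {x} m nx≈ε = trans (sym (×-assocˡ x m n)) (trans (×-congʳ m nx≈ε) (n·ε≈ε m))

  Bézout-exponents⇒≈ε : ∀ {u v x} s t → u · x ≈ ε → v · x ≈ ε → 1 ℕ.+ t ℕ.* v ≡ s ℕ.* u → x ≈ ε
  Bézout-exponents⇒≈ε {u} {v} {x} s t ux≈ε vx≈ε 1+tv≡su = begin
    x                  ≈⟨ sym (identityʳ x) ⟩
    x ∙ ε              ≈⟨ ∙-congˡ (sym (n·x≈ε⇒[m*n]·x≈ε t vx≈ε)) ⟩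
    suc (t ℕ.* v) · x  ≡⟨ ≡.cong (_· x) 1+tv≡su ⟩
    (s ℕ.* u) · x      ≈⟨ n·x≈ε⇒[m*n]·x≈ε s ux≈ε ⟩
    ε                  ∎

  coprime-exponents⇒≈ε : ∀ {u v x} → Coprime u v → u · x ≈ ε → v · x ≈ ε → x ≈ ε
  coprime-exponents⇒≈ε u⊥v ux≈ε vx≈ε with coprime-Bézout u⊥v
  ... | Bézout.+- s t 1+tv≡su = Bézout-exponents⇒≈ε s t ux≈ε vx≈ε 1+tv≡su
  ... | Bézout.-+ s t 1+su≡tv = Bézout-exponents⇒≈ε t s vx≈ε ux≈ε 1+su≡tv

  sum-replicate-except : ∀ {n} (g : Fin n → Carrier) j x → g j ≈ ε → (∀ i → i ≢ j → g i ≈ x) →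
                         sum g ≈ (n ℕ.∸ 1) · x
  sum-replicate-except {suc n} g Fin.zero x gj≈ε g≈x = begin
    g Fin.zero ∙ sum (g ∘ Fin.suc) ≈⟨ ∙-cong gj≈ε (sum-cong-≋ λ i → g≈x (Fin.suc i) λ ()) ⟩
    ε ∙ sum {n} (λ _ → x)          ≈⟨ identityˡ _ ⟩
    sum {n} (λ _ → x)              ≈⟨ sum-replicate n ⟩
    n · x                          ∎
  sum-replicate-except {suc (suc n)} g (Fin.suc j) x gj≈ε g≈x =
    ∙-cong (g≈x Fin.zero λ ())
           (sum-replicate-except (g ∘ Fin.suc) j x gj≈ε λ i i≢j → g≈x (Fin.suc i) (i≢j ∘ Fin.suc-injective))

module FieldProperties {c ℓ} (F : Field c ℓ) where
  open Field F
  open RS (Semiring.rawSemiring semiring) using (_^_) renaming (_×_ to _·_)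
  open Algebra.Properties.Group +-group
    using ( ⁻¹-injective; ⁻¹-involutive; ε⁻¹≈ε; x∙y⁻¹≈ε⇒x≈y; x≈y⇒x∙y⁻¹≈ε; identityʳ-unique
          ; //-rightDividesˡ; //-rightDividesʳ)
  open Algebra.Properties.Ring ring using (x[y-z]≈xy-xz; [y-z]x≈yx-zx; -1*x≈-x)
  open Algebra.Properties.Semiring.Exp semiring using (^-congˡ)
  open Algebra.Properties.CommutativeSemiring.Exp commutativeSemiring using (^-distrib-*)
  open Algebra.Properties.CommutativeMonoid.Sum *-commutativeMonoid using () renaming (sum to product)
  open import Relation.Binary.Reasoning.Setoid setoid

  x≉0∧x*y≈0⇒y≈0 : ∀ {x y} → x ≉ 0# → x * y ≈ 0# → y ≈ 0#
  x≉0∧x*y≈0⇒y≈0 {x} {y} x≉0 xy≈0 with inverse x x≉0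
  ... | x⁻¹ , xx⁻¹≈1 = begin
    y              ≈⟨ sym (*-identityˡ y) ⟩
    1# * y         ≈⟨ *-congʳ (trans (sym xx⁻¹≈1) (*-comm x x⁻¹)) ⟩
    (x⁻¹ * x) * y  ≈⟨ *-assoc x⁻¹ x y ⟩
    x⁻¹ * (x * y)  ≈⟨ *-congˡ xy≈0 ⟩
    x⁻¹ * 0#       ≈⟨ zeroʳ x⁻¹ ⟩
    0#             ∎

  x≉0∧y≉0⇒x*y≉0 : ∀ {x y} → x ≉ 0# → y ≉ 0# → x * y ≉ 0#
  x≉0∧y≉0⇒x*y≉0 x≉0 y≉0 = y≉0 ∘ x≉0∧x*y≈0⇒y≈0 x≉0

  x≉0⇒xⁿ≉0 : ∀ {x} n → x ≉ 0# → x ^ n ≉ 0#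
  x≉0⇒xⁿ≉0 zero    _   = 1≉0
  x≉0⇒xⁿ≉0 (suc n) x≉0 = x≉0∧y≉0⇒x*y≉0 x≉0 (x≉0⇒xⁿ≉0 n x≉0)

  x≉0⇒-x≉0 : ∀ {x} → x ≉ 0# → - x ≉ 0#
  x≉0⇒-x≉0 x≉0 -x≈0 = x≉0 (⁻¹-injective (trans -x≈0 (sym ε⁻¹≈ε)))

  *-cancelˡ-≉0 : ∀ {w x y} → w ≉ 0# → w * x ≈ w * y → x ≈ y
  *-cancelˡ-≉0 {w} {x} {y} w≉0 wx≈wy =
    x∙y⁻¹≈ε⇒x≈y x y (x≉0∧x*y≈0⇒y≈0 w≉0 (trans (x[y-z]≈xy-xz w x y) (x≈y⇒x∙y⁻¹≈ε wx≈wy)))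

  0ⁿ≈0 : ∀ n .{{_ : NonZero n}} → 0# ^ n ≈ 0#
  0ⁿ≈0 (suc n) = zeroˡ _

  1ⁿ≈1 : ∀ n → 1# ^ n ≈ 1#
  1ⁿ≈1 zero    = refl
  1ⁿ≈1 (suc n) = trans (*-identityˡ _) (1ⁿ≈1 n)

  product-≉0 : ∀ {n} (g : Fin n → Carrier) → (∀ i → g i ≉ 0#) → product g ≉ 0#
  product-≉0 {zero}  g _    = 1≉0
  product-≉0 {suc n} g g≉0 = x≉0∧y≉0⇒x*y≉0 (g≉0 Fin.zero) (product-≉0 (g ∘ Fin.suc) (g≉0 ∘ Fin.suc))

  mutual-inverses : (f g : Carrier → Carrier) → Congruent _≈_ _≈_ f → Congruent _≈_ _≈_ g →
                    (∀ x → f (g x) ≈ x) → (∀ x → g (f x) ≈ x) → Inverse setoid setoid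
  mutual-inverses f g f-cong g-cong fg≈id gf≈id = record
    { to        = f
    ; from      = g
    ; to-cong   = f-cong
    ; from-cong = g-cong
    ; inverse   = (λ y≈gx → trans (f-cong y≈gx) (fg≈id _)) , (λ y≈fx → trans (g-cong y≈fx) (gf≈id _))
    }

  +-translation : Carrier → Inverse setoid setoid
  +-translation a = mutual-inverses (_+ a) (_- a) +-congʳ +-congʳ (//-rightDividesˡ a) (//-rightDividesʳ a)

  *-scaling : ∀ a → a ≉ 0# → Inverse setoid setoid
  *-scaling a a≉0 with inverse a a≉0
  ... | a⁻¹ , aa⁻¹≈1 =
    mutual-inverses (a *_) (a⁻¹ *_) *-congˡ *-congˡ (cancel aa⁻¹≈1) (cancel (trans (*-comm a⁻¹ a) aa⁻¹≈1))
    where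
    cancel : ∀ {u v} → u * v ≈ 1# → ∀ x → u * (v * x) ≈ x
    cancel {u} {v} uv≈1 x = trans (sym (*-assoc u v x)) (trans (*-congʳ uv≈1) (*-identityˡ x))

  ·1≈0∧coprime⇒·1≉0 : ∀ {u v} → u · 1# ≈ 0# → Coprime u v → v · 1# ≉ 0#
  ·1≈0∧coprime⇒·1≉0 u·1≈0 u⊥v v·1≈0 = 1≉0 (coprime-exponents⇒≈ε +-monoid u⊥v u·1≈0 v·1≈0)

  eval : List Carrier → Carrier → Carrier
  eval []       x = 0#
  eval (c ∷ cs) x = c + x * eval cs x

  divide : Carrier → Carrier → List Carrier → List Carrier × Carrier
  divide a c []        = [] , c
  divide a c (c′ ∷ cs) = let (Q , r) = divide a c′ cs in r ∷ Q , c + a * r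

  quotient : Carrier → Carrier → List Carrier → List Carrier
  quotient a c cs = proj₁ (divide a c cs)

  remainder : Carrier → Carrier → List Carrier → Carrier
  remainder a c cs = proj₂ (divide a c cs)

  open Tactic.RingSolver.NonReflective (fromCommutativeRing commRing (λ _ → nothing))
    using (solve; _⊜_; _⊕_; _⊗_)

  -- P(x) = (x - a) Q(x) + r, stated without subtraction: lacking a zero test, the ring
  -- solver cannot cancel a r against - a r.
  divide-correct : ∀ a c cs x →
                   eval (c ∷ cs) x + a * eval (quotient a c cs) x ≈ x * eval (quotient a c cs) x + remainder a c cs
  divide-correct a c [] x = begin
    (c + x * 0#) + a * 0#  ≈⟨ +-cong (trans (+-congˡ (zeroʳ x)) (+-identityʳ c)) (zeroʳ a) ⟩
    c + 0#                 ≈⟨ +-comm c 0# ⟩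
    0# + c                 ≈⟨ +-congʳ (sym (zeroʳ x)) ⟩
    x * 0# + c             ∎
  divide-correct a c (c′ ∷ cs) x = begin
    (c + x * E) + a * (r + x * Q)  ≈⟨ solve 6 (λ x a Q r c E → ((c ⊕ x ⊗ E) ⊕ a ⊗ (r ⊕ x ⊗ Q))
                                                         ⊜ (c ⊕ a ⊗ r ⊕ x ⊗ (E ⊕ a ⊗ Q))) refl x a Q r c E ⟩
    c + a * r + x * (E + a * Q)    ≈⟨ +-congˡ (*-congˡ (divide-correct a c′ cs x)) ⟩
    c + a * r + x * (x * Q + r)    ≈⟨ solve 5 (λ x a Q r c → (c ⊕ a ⊗ r ⊕ x ⊗ (x ⊗ Q ⊕ r))
                                                       ⊜ (x ⊗ (r ⊕ x ⊗ Q) ⊕ (c ⊕ a ⊗ r))) refl x a Q r c ⟩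
    x * (r + x * Q) + (c + a * r)  ∎
    where
    E = eval (c′ ∷ cs) x
    Q = eval (quotient a c′ cs) x
    r = remainder a c′ cs

  length-quotient : ∀ a c cs → length (quotient a c cs) ≡ length cs
  length-quotient a c []        = ≡.refl
  length-quotient a c (c′ ∷ cs) = ≡.cong suc (length-quotient a c′ cs)

  divide-zero : ∀ a c cs → All (_≈ 0#) (quotient a c cs) → remainder a c cs ≈ 0# → All (_≈ 0#) (c ∷ cs)
  divide-zero a c []        []          c≈0 = c≈0 ∷ []
  divide-zero a c (c′ ∷ cs) (r≈0 ∷ Q≈0) c+ar≈0 =
    trans (sym (trans (+-congˡ (trans (*-congˡ r≈0) (zeroʳ a))) (+-identityʳ c))) c+ar≈0
    ∷ divide-zero a c′ cs Q≈0 r≈0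

  distinct-roots⇒zero : ∀ n (root : Fin n → Carrier) → Injective _≡_ _≈_ root →
                        ∀ cs → length cs ℕ.≤ n → (∀ i → eval cs (root i) ≈ 0#) → All (_≈ 0#) cs
  distinct-roots⇒zero n       root root-inj []       _         _      = []
  distinct-roots⇒zero (suc n) root root-inj (c ∷ cs) (s≤s len≤n) vanish =
    divide-zero a c cs
      (distinct-roots⇒zero n (root ∘ Fin.suc) (Fin.suc-injective ∘ root-inj) (quotient a c cs)
        (≡.subst (ℕ._≤ n) (≡.sym (length-quotient a c cs)) len≤n) Q-vanish)
      r≈0
    where
    a = root Fin.zero
    Q = eval (quotient a c cs)
    r = remainder a c cs
    at-root : ∀ i → a * Q (root i) ≈ root i * Q (root i) + r
    at-root i = trans (sym (trans (+-congʳ (vanish i)) (+-identityˡ _))) (divide-correct a c cs (root i))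
    r≈0 : r ≈ 0#
    r≈0 = identityʳ-unique _ r (sym (at-root Fin.zero))
    Q-vanish : ∀ i → Q (root (Fin.suc i)) ≈ 0#
    Q-vanish i = x≉0∧x*y≈0⇒y≈0 (λ a-b≈0 → Fin.0≢1+n (root-inj (x∙y⁻¹≈ε⇒x≈y a _ a-b≈0)))
      (trans ([y-z]x≈yx-zx _ a _) (x≈y⇒x∙y⁻¹≈ε aQ≈bQ))
      where
      aQ≈bQ : a * Q (root (Fin.suc i)) ≈ root (Fin.suc i) * Q (root (Fin.suc i))
      aQ≈bQ = trans (at-root (Fin.suc i)) (trans (+-congˡ r≈0) (+-identityʳ _))

  monomial : ℕ → List Carrier
  monomial zero    = 1# ∷ []
  monomial (suc n) = 0# ∷ monomial n

  eval-monomial : ∀ n x → eval (monomial n) x ≈ x ^ n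
  eval-monomial zero    x = trans (+-congˡ (zeroʳ x)) (+-identityʳ 1#)
  eval-monomial (suc n) x = trans (+-identityˡ _) (*-congˡ (eval-monomial n x))

  length-monomial : ∀ n → length (monomial n) ≡ suc n
  length-monomial zero    = ≡.refl
  length-monomial (suc n) = ≡.cong suc (length-monomial n)

  monomial≉0 : ∀ n → ¬ All (_≈ 0#) (monomial n)
  monomial≉0 zero    (1≈0 ∷ _) = 1≉0 1≈0
  monomial≉0 (suc n) (_ ∷ cs≈0) = monomial≉0 n cs≈0

  injective-≗ : ∀ {f g : Carrier → Carrier} → (∀ x → f x ≈ g x) → Injective _≈_ _≈_ f → Injective _≈_ _≈_ g
  injective-≗ f≈g f-inj gx≈gy = f-inj (trans (f≈g _) (trans gx≈gy (sym (f≈g _))))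

  xⁿ≈yⁿ⇒[-x]ⁿ≈[-y]ⁿ : ∀ {x y} n → x ^ n ≈ y ^ n → (- x) ^ n ≈ (- y) ^ n
  xⁿ≈yⁿ⇒[-x]ⁿ≈[-y]ⁿ {x} {y} n xⁿ≈yⁿ = begin
    (- x) ^ n           ≈⟨ ^-congˡ n (sym (-1*x≈-x x)) ⟩
    (- 1# * x) ^ n      ≈⟨ ^-distrib-* (- 1#) x n ⟩
    (- 1#) ^ n * x ^ n  ≈⟨ *-congˡ xⁿ≈yⁿ ⟩
    (- 1#) ^ n * y ^ n  ≈⟨ sym (^-distrib-* (- 1#) y n) ⟩
    (- 1# * y) ^ n      ≈⟨ ^-congˡ n (-1*x≈-x y) ⟩
    (- y) ^ n           ∎

  γ*[-x]ˡ-injective⇔ : ∀ γ l → Injective _≈_ _≈_ (λ x → γ * (- x) ^ l) ⇔ (γ ≉ 0# × Injective _≈_ _≈_ (_^ l))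
  γ*[-x]ˡ-injective⇔ γ l = mk⇔ < γ≉0 , ^-injective > (uncurry γ*[-x]ˡ-injective)
    where
    γ≉0 : Injective _≈_ _≈_ (λ x → γ * (- x) ^ l) → γ ≉ 0#
    γ≉0 inj γ≈0 = 1≉0 (inj (trans (annihilated 1#) (sym (annihilated 0#))))
      where
      annihilated : ∀ x → γ * (- x) ^ l ≈ 0#
      annihilated x = trans (*-congʳ γ≈0) (zeroˡ _)
    ^-injective : Injective _≈_ _≈_ (λ x → γ * (- x) ^ l) → Injective _≈_ _≈_ (_^ l)
    ^-injective inj xˡ≈yˡ = inj (*-congˡ (xⁿ≈yⁿ⇒[-x]ⁿ≈[-y]ⁿ l xˡ≈yˡ))
    γ*[-x]ˡ-injective : γ ≉ 0# → Injective _≈_ _≈_ (_^ l) → Injective _≈_ _≈_ (λ x → γ * (- x) ^ l)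
    γ*[-x]ˡ-injective γ≉0 xˡ-inj {x} {y} γ[-x]ˡ≈γ[-y]ˡ = xˡ-inj (begin
      x ^ l        ≈⟨ ^-congˡ l (sym (⁻¹-involutive x)) ⟩
      (- - x) ^ l  ≈⟨ xⁿ≈yⁿ⇒[-x]ⁿ≈[-y]ⁿ l (*-cancelˡ-≉0 γ≉0 γ[-x]ˡ≈γ[-y]ˡ) ⟩
      (- - y) ^ l  ≈⟨ ^-congˡ l (⁻¹-involutive y) ⟩
      y ^ l        ∎)

module FiniteFieldProperties {c ℓ q} (F : FiniteField c ℓ q) where
  open FiniteField F
  open FieldProperties fld
  open RS (Semiring.rawSemiring semiring) using (_^_) renaming (_×_ to _·_)
  open Inverse card using (to; from; to-cong; strictlyInverseˡ; strictlyInverseʳ)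
  open Algebra.Properties.Group +-group using (identityʳ-unique)
  open Algebra.Properties.Semiring.Exp semiring using (^-congˡ; ^-congʳ; ^-assocʳ)
  open Algebra.Properties.CommutativeSemiring.Exp commutativeSemiring using (^-distrib-*)
  open Algebra.Properties.Ring ring using (-1*x≈-x)
  module Σ⁺ = Algebra.Properties.CommutativeMonoid.Sum +-commutativeMonoid
  module Π = Algebra.Properties.CommutativeMonoid.Sum *-commutativeMonoid
  open import Relation.Binary.Reasoning.Setoid setoid

  to-injective : Injective _≈_ _≡_ to
  to-injective = Injection.injective (Inverse⇒Injection card)

  from-injective : Injective _≡_ _≈_ from
  from-injective = Injection.injective (Inverse⇒Injection (Symmetry.inverse card))

  infix 4 _≟_
  _≟_ : Decidable _≈_
  x ≟ y = Dec.map′ to-injective to-cong (to x Fin.≟ to y)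

  injective⇒IsPP : ∀ {f} → Congruent _≈_ _≈_ f → Injective _≈_ _≈_ f → IsPP F f
  injective⇒IsPP {f} f-cong f-inj = f-inj , surjective
    where
    surjective : Surjective _≈_ _≈_ f
    surjective y with Fin-injective⇒surjective (to ∘ f ∘ from) (from-injective ∘ f-inj ∘ to-injective) (to y)
    ... | i , eq = from i , λ z≈from-i → trans (f-cong z≈from-i) (to-injective eq)

  module _ {a r} (M : CommutativeMonoid a r) where
    open CommutativeMonoid M using () renaming (Carrier to A; _≈_ to _≈ᴹ_; trans to transᴹ)
    open Algebra.Properties.CommutativeMonoid.Sum M using (sum; sum-permute; sum-cong-≋)

    sum-invariant : (h : Carrier → A) → Congruent _≈_ _≈ᴹ_ h → (σ : Inverse setoid setoid) →
                    sum (h ∘ from) ≈ᴹ sum (h ∘ Inverse.to σ ∘ from)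
    sum-invariant h h-cong σ =
      transᴹ (sum-permute (h ∘ from) π) (sum-cong-≋ λ i → h-cong (strictlyInverseʳ (Inverse.to σ (from i))))
      where
      π : Permutation q q
      π = Composition.inverse (Symmetry.inverse card) (Composition.inverse σ card)

  q·x≈0 : ∀ x → q · x ≈ 0#
  q·x≈0 x = identityʳ-unique S (q · x) (sym (begin
    S                           ≈⟨ sum-invariant +-commutativeMonoid id id (+-translation x) ⟩
    Σ⁺.sum (λ i → from i + x)   ≈⟨ Σ⁺.∑-distrib-+ from (λ _ → x) ⟩
    S + Σ⁺.sum {q} (λ _ → x)    ≈⟨ +-congˡ (Σ⁺.sum-replicate q) ⟩
    S + q · x                   ∎))
    where
    S = Σ⁺.sum from

  0↦1 : Carrier → Carrier
  0↦1 x with x ≟ 0#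
  ... | yes _ = 1#
  ... | no  _ = x

  0↦1≉0 : ∀ x → 0↦1 x ≉ 0#
  0↦1≉0 x with x ≟ 0#
  ... | yes _   = 1≉0
  ... | no  x≉0 = x≉0

  0↦1-cong : Congruent _≈_ _≈_ 0↦1
  0↦1-cong {x} {y} x≈y with x ≟ 0# | y ≟ 0#
  ... | yes _   | yes _   = refl
  ... | yes x≈0 | no  y≉0 = contradiction (trans (sym x≈y) x≈0) y≉0
  ... | no  x≉0 | yes y≈0 = contradiction (trans x≈y y≈0) x≉0
  ... | no  _   | no  _   = x≈y

  scale : Carrier → Carrier → Carrier
  scale a x with x ≟ 0#
  ... | yes _ = 1#
  ... | no  _ = a

  0↦1-* : ∀ {a} → a ≉ 0# → ∀ x → 0↦1 (a * x) ≈ scale a x * 0↦1 x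
  0↦1-* {a} a≉0 x with a * x ≟ 0# | x ≟ 0#
  ... | yes _    | yes _   = sym (*-identityˡ 1#)
  ... | yes ax≈0 | no  x≉0 = contradiction ax≈0 (x≉0∧y≉0⇒x*y≉0 a≉0 x≉0)
  ... | no  ax≉0 | yes x≈0 = contradiction (trans (*-congˡ x≈0) (zeroʳ a)) ax≉0
  ... | no  _    | no  _   = refl

  scale-0 : ∀ a {x} → x ≈ 0# → scale a x ≈ 1#
  scale-0 a {x} x≈0 with x ≟ 0#
  ... | yes _   = refl
  ... | no  x≉0 = contradiction x≈0 x≉0

  scale-≉0 : ∀ a {x} → x ≉ 0# → scale a x ≈ a
  scale-≉0 a {x} x≉0 with x ≟ 0#
  ... | yes x≈0 = contradiction x≈0 x≉0
  ... | no  _   = refl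

  -- Multiplication by a permutes F; compare the products of the nonzero elements before and
  -- after (0↦1 turns the element 0 into a neutral factor).
  fermat : ∀ {a} → a ≉ 0# → a ^ (q ℕ.∸ 1) ≈ 1#
  fermat {a} a≉0 = sym (*-cancelˡ-≉0 (product-≉0 (0↦1 ∘ from) (0↦1≉0 ∘ from)) (begin
    P * 1#                              ≈⟨ *-identityʳ P ⟩
    P                                   ≈⟨ sum-invariant *-commutativeMonoid 0↦1 0↦1-cong (*-scaling a a≉0) ⟩
    Π.sum (0↦1 ∘ (a *_) ∘ from)         ≈⟨ Π.sum-cong-≋ (0↦1-* a≉0 ∘ from) ⟩
    Π.sum (λ i → S i * 0↦1 (from i))    ≈⟨ Π.∑-distrib-+ S (0↦1 ∘ from) ⟩
    Π.sum S * P                         ≈⟨ *-congʳ scale-product ⟩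
    a ^ (q ℕ.∸ 1) * P                   ≈⟨ *-comm _ P ⟩
    P * a ^ (q ℕ.∸ 1)                   ∎))
    where
    P = Π.sum (0↦1 ∘ from)
    S = scale a ∘ from
    scale-product : Π.sum S ≈ a ^ (q ℕ.∸ 1)
    scale-product = sum-replicate-except *-monoid S (to 0#) a
      (scale-0 a (strictlyInverseʳ 0#))
      (λ i i≢to0 → scale-≉0 a (λ from-i≈0 → i≢to0 (≡.trans (≡.sym (strictlyInverseˡ i)) (to-cong from-i≈0))))

  prime-power-order⇒·1≉0 : ∀ {p} m → Prime p → q ≡ p ℕ.^ m → ∀ {j} → 0 ℕ.< j → j ℕ.< p → j · 1# ≉ 0#
  prime-power-order⇒·1≉0 {p} m p-prime q≡pᵐ {j} 0<j j<p = ·1≈0∧coprime⇒·1≉0 (q·x≈0 1#)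
    (≡.subst (λ n → Coprime n j) (≡.sym q≡pᵐ) (coprime-^ˡ m (prime⇒coprime p-prime {{ℕ.>-nonZero 0<j}} j<p)))

  x^n≈0⇒x≈0 : ∀ {x} n → x ^ n ≈ 0# → x ≈ 0#
  x^n≈0⇒x≈0 {x} n xⁿ≈0 = decidable-stable (x ≟ 0#) (λ x≉0 → x≉0⇒xⁿ≉0 n x≉0 xⁿ≈0)

  coprime⇒^-injective : ∀ {l} .{{_ : NonZero l}} → Coprime l (q ℕ.∸ 1) → Injective _≈_ _≈_ (_^ l)
  coprime⇒^-injective {l} l⊥q-1 {x} {y} xˡ≈yˡ with y ≟ 0#
  ... | yes y≈0 = trans (x^n≈0⇒x≈0 l (trans xˡ≈yˡ (trans (^-congˡ l y≈0) (0ⁿ≈0 l)))) (sym y≈0)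
  ... | no  y≉0 with inverse y y≉0
  ...   | y⁻¹ , yy⁻¹≈1 = begin
    x                ≈⟨ sym (*-identityʳ x) ⟩
    x * 1#           ≈⟨ *-congˡ (sym (trans (*-comm y⁻¹ y) yy⁻¹≈1)) ⟩
    x * (y⁻¹ * y)    ≈⟨ sym (*-assoc x y⁻¹ y) ⟩
    (x * y⁻¹) * y    ≈⟨ *-congʳ u≈1 ⟩
    1# * y           ≈⟨ *-identityˡ y ⟩
    y                ∎
    where
    u≉0 : x * y⁻¹ ≉ 0#
    u≉0 = x≉0∧y≉0⇒x*y≉0 (λ x≈0 → y≉0 (x^n≈0⇒x≈0 l (trans (sym xˡ≈yˡ) (trans (^-congˡ l x≈0) (0ⁿ≈0 l)))))
                         (λ y⁻¹≈0 → 1≉0 (trans (sym yy⁻¹≈1) (trans (*-congˡ y⁻¹≈0) (zeroʳ y))))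
    uˡ≈1 : (x * y⁻¹) ^ l ≈ 1#
    uˡ≈1 = begin
      (x * y⁻¹) ^ l     ≈⟨ ^-distrib-* x y⁻¹ l ⟩
      x ^ l * y⁻¹ ^ l   ≈⟨ *-congʳ xˡ≈yˡ ⟩
      y ^ l * y⁻¹ ^ l   ≈⟨ sym (^-distrib-* y y⁻¹ l) ⟩
      (y * y⁻¹) ^ l     ≈⟨ ^-congˡ l yy⁻¹≈1 ⟩
      1# ^ l            ≈⟨ 1ⁿ≈1 l ⟩
      1#                ∎
    u≈1 : x * y⁻¹ ≈ 1#
    u≈1 = coprime-exponents⇒≈ε *-monoid l⊥q-1 uˡ≈1 (fermat u≉0)

  x*x^[q∸1]≈x : ∀ x → x * x ^ (q ℕ.∸ 1) ≈ x
  x*x^[q∸1]≈x x with x ≟ 0#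
  ... | yes x≈0 = trans (trans (*-congʳ x≈0) (zeroˡ _)) (sym x≈0)
  ... | no  x≉0 = trans (*-congˡ (fermat x≉0)) (*-identityʳ x)

  x^[1+n]*x^[q∸1]≈x^[1+n] : ∀ x n → x ^ suc n * x ^ (q ℕ.∸ 1) ≈ x ^ suc n
  x^[1+n]*x^[q∸1]≈x^[1+n] x n = begin
    (x * x ^ n) * w  ≈⟨ *-assoc x _ w ⟩
    x * (x ^ n * w)  ≈⟨ *-congˡ (*-comm _ w) ⟩
    x * (w * x ^ n)  ≈⟨ sym (*-assoc x w _) ⟩
    (x * w) * x ^ n  ≈⟨ *-congʳ (x*x^[q∸1]≈x x) ⟩
    x * x ^ n        ∎
    where
    w = x ^ (q ℕ.∸ 1)

  ^-injective-∣ : ∀ {d l} → d ∣ l → Injective _≈_ _≈_ (_^ l) → Injective _≈_ _≈_ (_^ d)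
  ^-injective-∣ {d} (divides e ≡.refl) xˡ-inj {x} {y} xᵈ≈yᵈ = xˡ-inj (begin
    x ^ (e ℕ.* d)  ≈⟨ x^[e*d]≈[x^d]^e x ⟩
    (x ^ d) ^ e    ≈⟨ ^-congˡ e xᵈ≈yᵈ ⟩
    (y ^ d) ^ e    ≈⟨ sym (x^[e*d]≈[x^d]^e y) ⟩
    y ^ (e ℕ.* d)  ∎)
    where
    x^[e*d]≈[x^d]^e : ∀ z → z ^ (e ℕ.* d) ≈ (z ^ d) ^ e
    x^[e*d]≈[x^d]^e z = trans (^-congʳ z (ℕ.*-comm e d)) (sym (^-assocʳ z d e))

  ¬∀x^[2+s]≈x : ∀ s → 3 ℕ.+ s ℕ.≤ q → ¬ (∀ x → x ^ (2 ℕ.+ s) ≈ x)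
  ¬∀x^[2+s]≈x s 3+s≤q fixed
    with distinct-roots⇒zero q from from-injective (0# ∷ - 1# ∷ monomial s) length≤q vanish
    where
    length≤q : length (0# ∷ - 1# ∷ monomial s) ℕ.≤ q
    length≤q = ≡.subst (ℕ._≤ q) (≡.cong (2 ℕ.+_) (≡.sym (length-monomial s))) 3+s≤q
    vanish : ∀ i → eval (0# ∷ - 1# ∷ monomial s) (from i) ≈ 0#
    vanish i = let x = from i in begin
      0# + x * (- 1# + x * eval (monomial s) x)  ≈⟨ +-identityˡ _ ⟩
      x * (- 1# + x * eval (monomial s) x)       ≈⟨ *-congˡ (+-congˡ (*-congˡ (eval-monomial s x))) ⟩
      x * (- 1# + x ^ suc s)                     ≈⟨ distribˡ x (- 1#) _ ⟩
      x * - 1# + x ^ (2 ℕ.+ s)                   ≈⟨ +-cong (trans (*-comm x (- 1#)) (-1*x≈-x x)) (fixed x) ⟩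
      - x + x                                    ≈⟨ -‿inverseˡ x ⟩
      0#                                         ∎
  ... | _ ∷ _ ∷ monomial≈0 = monomial≉0 s monomial≈0

  ^-injective∧∣[q∸1]⇒≡1 : 2 ℕ.≤ q → ∀ {d} → d ∣ q ℕ.∸ 1 → Injective _≈_ _≈_ (_^ d) → d ≡ 1
  ^-injective∧∣[q∸1]⇒≡1 2≤q {0} (divides t q-1≡t*0) _ =
    contradiction (≡.trans q-1≡t*0 (ℕ.*-zeroʳ t)) (ℕ.>⇒≢ (ℕ.m<n⇒0<n∸m 2≤q))
  ^-injective∧∣[q∸1]⇒≡1 2≤q {1} _ _ = ≡.refl
  ^-injective∧∣[q∸1]⇒≡1 2≤q {suc (suc _)} (divides zero q-1≡0) _ =
    contradiction q-1≡0 (ℕ.>⇒≢ (ℕ.m<n⇒0<n∸m 2≤q))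
  ^-injective∧∣[q∸1]⇒≡1 2≤q {d@(suc d′@(suc _))} (divides (suc s) q-1≡[1+s]d) xᵈ-inj =
    ⊥-elim (¬∀x^[2+s]≈x s (cofactor-bound (ℕ.<⇒≤ 2≤q) q-1≡[1+s]d) every-fixed)
    where
    d[1+s]≡q-1 : d ℕ.* suc s ≡ q ℕ.∸ 1
    d[1+s]≡q-1 = ≡.trans (ℕ.*-comm d (suc s)) (≡.sym q-1≡[1+s]d)
    every-fixed : ∀ y → y ^ (2 ℕ.+ s) ≈ y
    every-fixed y with proj₂ (injective⇒IsPP (^-congˡ d) xᵈ-inj) y
    ... | x , xᵈ≈y = begin
      y ^ (2 ℕ.+ s)                ≈⟨ ^-congˡ (2 ℕ.+ s) (sym (xᵈ≈y refl)) ⟩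
      x ^ d * (x ^ d) ^ suc s      ≈⟨ *-congˡ (^-assocʳ x d (suc s)) ⟩
      x ^ d * x ^ (d ℕ.* suc s)    ≡⟨ ≡.cong (λ e → x ^ d * x ^ e) d[1+s]≡q-1 ⟩
      x ^ d * x ^ (q ℕ.∸ 1)        ≈⟨ x^[1+n]*x^[q∸1]≈x^[1+n] x d′ ⟩
      x ^ d                        ≈⟨ xᵈ≈y refl ⟩
      y                            ∎

  ^-injective⇔coprime : 3 ℕ.≤ q → ∀ l → Injective _≈_ _≈_ (_^ l) ⇔ (gcd l (q ℕ.∸ 1) ≡ 1)
  ^-injective⇔coprime 3≤q l = mk⇔ injective⇒gcd≡1 (gcd≡1⇒injective l)
    where
    injective⇒gcd≡1 : Injective _≈_ _≈_ (_^ l) → gcd l (q ℕ.∸ 1) ≡ 1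
    injective⇒gcd≡1 xˡ-inj =
      ^-injective∧∣[q∸1]⇒≡1 (ℕ.<⇒≤ 3≤q) (gcd[m,n]∣n l _) (^-injective-∣ (gcd[m,n]∣m l _) xˡ-inj)
    gcd≡1⇒injective : ∀ l → gcd l (q ℕ.∸ 1) ≡ 1 → Injective _≈_ _≈_ (_^ l)
    gcd≡1⇒injective zero    q-1≡1 =
      contradiction (≡.trans (≡.sym (gcd-identityˡ _)) q-1≡1) (ℕ.>⇒≢ (ℕ.∸-monoˡ-≤ 1 3≤q))
    gcd≡1⇒injective (suc l) gcd≡1 = coprime⇒^-injective (gcd≡1⇒coprime gcd≡1)

module DicksonAtZero {c ℓ q} (F : FiniteField c ℓ q) where
  open FiniteField F
  open FieldProperties fld
  open FiniteFieldProperties F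
  open RS (Semiring.rawSemiring semiring) using (_^_)
  open Algebra.Properties.Semiring.Exp semiring using (^-congˡ)
  open import Relation.Binary.Reasoning.Setoid setoid

  ⟦_⟧ : ℤ → Carrier
  ⟦_⟧ = ⟦_⟧ℤ F

  ⟦2-k⟧≉0 : ∀ {p} m → Prime p → p ≢ 2 → q ≡ p ℕ.^ m → ∀ {k} → k ℕ.< p → k ≢ 2 → ⟦ + 2 ℤ.- + k ⟧ ≉ 0#
  ⟦2-k⟧≉0 m p-prime p≢2 q≡pᵐ {0} _ _ =
    prime-power-order⇒·1≉0 m p-prime q≡pᵐ z<s (odd-prime⇒3≤p p-prime p≢2)
  ⟦2-k⟧≉0 m p-prime p≢2 q≡pᵐ {1} _ _ =
    prime-power-order⇒·1≉0 m p-prime q≡pᵐ z<s (ℕ.≤-trans (ℕ.n≤1+n 2) (odd-prime⇒3≤p p-prime p≢2))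
  ⟦2-k⟧≉0 m p-prime p≢2 q≡pᵐ {2} _ k≢2 = contradiction ≡.refl k≢2
  ⟦2-k⟧≉0 m p-prime p≢2 q≡pᵐ {suc (suc (suc j))} k<p _ =
    x≉0⇒-x≉0 (prime-power-order⇒·1≉0 m p-prime q≡pᵐ z<s (ℕ.m+n≤o⇒n≤o 2 k<p))

  sumUpTo-zero : ∀ M f → (∀ i → i ℕ.≤ M → f i ≈ 0#) → sumUpTo F M f ≈ 0#
  sumUpTo-zero zero    f f≈0 = f≈0 0 z≤n
  sumUpTo-zero (suc M) f f≈0 =
    trans (+-cong (sumUpTo-zero M f (λ i → f≈0 i ∘ ℕ.m≤n⇒m≤1+n)) (f≈0 (suc M) ℕ.≤-refl)) (+-identityˡ 0#)

  sumUpTo-last : ∀ M f → (∀ i → i ℕ.< M → f i ≈ 0#) → sumUpTo F M f ≈ f M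
  sumUpTo-last zero    f _   = refl
  sumUpTo-last (suc M) f f≈0 = trans (+-congʳ (sumUpTo-zero M f (λ i → f≈0 i ∘ s≤s))) (+-identityˡ _)

  term : ℕ → ℕ → Carrier → ℕ → Carrier
  term n k x i = (⟦ coeff F n k i ⟧ * (- x) ^ i) * 0# ^ (n ℕ.∸ 2 ℕ.* i)

  term-vanishes : ∀ n k x i → 2 ℕ.* i ℕ.< n → term n k x i ≈ 0#
  term-vanishes n k x i 2i<n =
    trans (*-congˡ (0ⁿ≈0 (n ℕ.∸ 2 ℕ.* i) {{ℕ.>-nonZero (ℕ.m<n⇒0<n∸m 2i<n)}})) (zeroʳ _)

  D-odd : ∀ l k x → D F (suc (2 ℕ.* l)) k 0# x ≈ 0#
  D-odd l k x = sumUpTo-zero _ (term _ k x) λ i i≤⌊n/2⌋ →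
    term-vanishes _ k x i (s≤s (ℕ.*-monoʳ-≤ 2 (≡.subst (i ℕ.≤_) (⌊1+2n/2⌋≡n l) i≤⌊n/2⌋)))

  coeff-at : ∀ {n k i m} → n ℕ.∸ i ≡ suc m →
             coeff F n k i ≡ ((+ n ℤ.- + (k ℕ.* i)) ℤ.* + (suc m C i)) ℤ./ℕ suc m
  coeff-at {n} {k} {i} n∸i≡1+m with n ℕ.∸ i in eq
  coeff-at {n} {k} {i} ≡.refl | suc m = ≡.cong (λ t → ((+ n ℤ.- + (k ℕ.* i)) ℤ.* + (t C i)) ℤ./ℕ suc m) eq

  coeff-middle : ∀ l k → coeff F (2 ℕ.* suc l) k (suc l) ≡ + 2 ℤ.- + k
  coeff-middle l k = ≡.trans (coeff-at {2 ℕ.* L} {k} {L} 2L∸L≡L) (middle-coefficient k L)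
    where
    L = suc l
    2L∸L≡L : 2 ℕ.* L ℕ.∸ L ≡ L
    2L∸L≡L = ≡.trans (ℕ.m+n∸m≡n L (L ℕ.+ 0)) (ℕ.+-identityʳ L)

  term-middle : ∀ l k x → term (2 ℕ.* suc l) k x (suc l) ≈ ⟦ + 2 ℤ.- + k ⟧ * (- x) ^ suc l
  term-middle l k x = begin
    γ′ * 0# ^ (2L ℕ.∸ 2L)            ≡⟨ ≡.cong (λ e → γ′ * 0# ^ e) (ℕ.n∸n≡0 2L) ⟩
    γ′ * 1#                          ≈⟨ *-identityʳ γ′ ⟩
    γ′                               ≡⟨ ≡.cong (λ z → ⟦ z ⟧ * (- x) ^ suc l) (coeff-middle l k) ⟩
    ⟦ + 2 ℤ.- + k ⟧ * (- x) ^ suc l  ∎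
    where
    2L = 2 ℕ.* suc l
    γ′ = ⟦ coeff F 2L k (suc l) ⟧ * (- x) ^ suc l

  D-even : ∀ l k x → D F (2 ℕ.* l) k 0# x ≈ ⟦ + 2 ℤ.- + k ⟧ * (- x) ^ l
  D-even zero    k x = sym (*-identityʳ _)
  D-even (suc l) k x = begin
    sumUpTo F ℕ.⌊ 2L /2⌋ (term 2L k x)  ≈⟨ sumUpTo-last _ (term 2L k x) earlier-terms-vanish ⟩
    term 2L k x ℕ.⌊ 2L /2⌋              ≡⟨ ≡.cong (term 2L k x) (⌊2n/2⌋≡n (suc l)) ⟩
    term 2L k x (suc l)                 ≈⟨ term-middle l k x ⟩
    ⟦ + 2 ℤ.- + k ⟧ * (- x) ^ suc l     ∎
    where
    2L = 2 ℕ.* suc l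
    earlier-terms-vanish : ∀ i → i ℕ.< ℕ.⌊ 2L /2⌋ → term 2L k x i ≈ 0#
    earlier-terms-vanish i i<⌊2L/2⌋ =
      term-vanishes 2L k x i (ℕ.*-monoʳ-< 2 (≡.subst (i ℕ.<_) (⌊2n/2⌋≡n (suc l)) i<⌊2L/2⌋))

  D-odd-¬IsPP : ∀ l k → ¬ IsPP F (λ x → D F (suc (2 ℕ.* l)) k 0# x)
  D-odd-¬IsPP l k (inj , _) = 1≉0 (inj (trans (D-odd l k 1#) (sym (D-odd l k 0#))))

  D-even-IsPP⇔ : ∀ l k → IsPP F (λ x → D F (2 ℕ.* l) k 0# x) ⇔ (⟦ + 2 ℤ.- + k ⟧ ≉ 0# × Injective _≈_ _≈_ (_^ l))
  D-even-IsPP⇔ l k = mk⇔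
    (λ (D-inj , _) → Equivalence.to (γ*[-x]ˡ-injective⇔ γ l) (injective-≗ (D-even l k) D-inj))
    (λ conds → injective⇒IsPP D-cong
      (injective-≗ (sym ∘ D-even l k) (Equivalence.from (γ*[-x]ˡ-injective⇔ γ l) conds)))
    where
    γ = ⟦ + 2 ℤ.- + k ⟧
    D-cong : Congruent _≈_ _≈_ (λ x → D F (2 ℕ.* l) k 0# x)
    D-cong x≈y = trans (D-even l k _) (trans (*-congˡ (^-congˡ l (-‿cong x≈y))) (sym (D-even l k _)))

open import Data.Nat using (_≤_; _∸_; _*_; _^_)

theorem2p1 : {c ℓ : Level} (p m q : ℕ) → Prime p → ¬ (p ≡ 2) → 1 ≤ m → q ≡ p ^ m →
    (F : FiniteField c ℓ q) → (k : ℕ) → k ≤ p ∸ 1 → (n : ℕ) →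
    IsPP F (λ x → D F n k (FiniteField.0# F) x)
      ⇔ ((¬ (k ≡ 2)) × Σ ℕ (λ l → (n ≡ 2 * l) × (gcd l (q ∸ 1) ≡ 1)))
theorem2p1 p m q p-prime p≢2 1≤m q≡pᵐ F k k≤p∸1 n = mk⇔ forward backward
  where
  open FiniteFieldProperties F
  open DicksonAtZero F
  open Equivalence
  3≤q : 3 ≤ q
  3≤q = ≡.subst (3 ≤_) (≡.sym q≡pᵐ) (odd-prime⇒3≤pᵐ p-prime p≢2 1≤m)
  forward : IsPP F (λ x → D F n k (FiniteField.0# F) x) →
            (¬ (k ≡ 2)) × Σ ℕ (λ l → (n ≡ 2 * l) × (gcd l (q ∸ 1) ≡ 1))
  forward PP with even⊎odd n
  ... | inj₂ (l , ≡.refl) = ⊥-elim (D-odd-¬IsPP l k PP)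
  ... | inj₁ (l , ≡.refl) with to (D-even-IsPP⇔ l k) PP
  ...   | 2-k≉0 , xˡ-inj =
    -- for k = 2 the constant ⟦ + 2 - + 2 ⟧ computes to 0#
    (λ { ≡.refl → 2-k≉0 (FiniteField.refl F) }) , l , ≡.refl , to (^-injective⇔coprime 3≤q l) xˡ-inj
  backward : (¬ (k ≡ 2)) × Σ ℕ (λ l → (n ≡ 2 * l) × (gcd l (q ∸ 1) ≡ 1)) →
             IsPP F (λ x → D F n k (FiniteField.0# F) x)
  backward (k≢2 , l , ≡.refl , gcd≡1) = from (D-even-IsPP⇔ l k)
    ( ⟦2-k⟧≉0 m p-prime p≢2 q≡pᵐ (ℕ.m≤pred[n]⇒suc[m]≤n {{prime⇒nonZero p-prime}} k≤p∸1) k≢2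
    , from (^-injective⇔coprime 3≤q l) gcd≡1 )
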